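{- Let $n,m$ be integers and $d\ge1$ an integer, and put $r_{k,m}=\dfrac{1}{2^k\,k!\,\prod_{l=0}^{k-1}(n+2m-4-2l)}$ for $0\le k\le d$. Then \[ \sum_{k=0}^d\Bigg(\prod_{l=k}^{d-1}\frac{1}{(2l-2d)(n-2+2m-2d-2l)}\Bigg)r_{k,m}=0, \] provided all the denominators occurring are nonzero.
   Context: Empty products equal $1$. -}

module Defs where

open import Data.Nat as ℕ using (ℕ; zero; suc; _∸_; _!)

open import Data.Integer as ℤ using (ℤ; +_)
open import Data.Rational as ℚ using (ℚ; 0ℚ; 1ℚ; ≢-nonZero)
open import Data.Rational.Properties using (_≟_)
open import Relation.Nullary using (yes; no)

⟦_⟧ : ℤ → ℚ
⟦ z ⟧ = z ℚ./ 1

-- total inverse on ℚ: the genuine 1/p for p ≢ 0, junk value 0 at 0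
-- (only ever used under hypotheses that make the argument nonzero)
inv : ℚ → ℚ
inv p with p ≟ 0ℚ
... | yes _ = 0ℚ
... | no p≢0 = ℚ.1/_ p {{≢-nonZero p≢0}}

prodℚ : ℕ → ℕ → (ℕ → ℚ) → ℚ
prodℚ a zero    f = 1ℚ
prodℚ a (suc c) f = f a ℚ.* prodℚ (suc a) c f

prodℤ : ℕ → ℕ → (ℕ → ℤ) → ℤ
prodℤ a zero    f = + 1
prodℤ a (suc c) f = f a ℤ.* prodℤ (suc a) c f

sumTo : ℕ → (ℕ → ℚ) → ℚ
sumTo zero    f = 0ℚ
sumTo (suc c) f = sumTo c f ℚ.+ f c

facA : ℤ → ℤ → ℕ → ℤ
facA n m l = n ℤ.+ + 2 ℤ.* m ℤ.- + 4 ℤ.- + 2 ℤ.* + l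

facB : ℤ → ℤ → ℕ → ℕ → ℤ
facB n m d l = n ℤ.- + 2 ℤ.+ + 2 ℤ.* m ℤ.- + 2 ℤ.* + d ℤ.- + 2 ℤ.* + l

facC : ℕ → ℕ → ℤ
facC d l = + 2 ℤ.* + l ℤ.- + 2 ℤ.* + d

r : ℤ → ℤ → ℕ → ℚ
r n m k = inv ⟦ + (2 ℕ.^ k) ℤ.* + (k !) ℤ.* prodℤ 0 k (facA n m) ⟧

coeff : ℤ → ℤ → ℕ → ℕ → ℚ
coeff n m d k = prodℚ k (d ∸ k) (λ l → inv ⟦ facC d l ℤ.* facB n m d l ⟧)

theSum : ℤ → ℤ → ℕ → ℚ
theSum n m d = sumTo (suc d) (λ k → coeff n m d k ℚ.* r n m k)

{-# OPTIONS --safe #-}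
module Submission where

-- Write t_k for the k-th summand, A, B, C for facA, facB, facC, and put
-- Q_k = C_k B_k, E_k = 2(k+1) A_k, K = 2d B_0.  Passing from k to k+1 the
-- product in t_k loses the factor 1/Q_k and r gains the factor 1/E_k, so
-- t_k Q_k = t_{k+1} E_k; moreover E_k = Q_{k+1} + K is an identity of
-- polynomials.  Hence K t_{k+1} = t_k Q_k - t_{k+1} Q_{k+1}, and with
-- Q_0 = -K the sum telescopes to K (t_0 + ... + t_d) = -t_d Q_d, which
-- vanishes because C_d = 0.

open import Defs
open import Data.Nat as ℕ using (ℕ; zero; suc; _≤_; _<_; _!)
import Data.Nat.Properties as ℕP
open import Data.Integer as ℤ using (ℤ; 0ℤ; +_)
import Data.Integer.Properties as ℤP
open import Data.Integer.Tactic.RingSolver using (solve-∀)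
open import Data.Rational as ℚ using (ℚ; 0ℚ; 1ℚ; ≢-nonZero; toℚᵘ)
import Data.Rational.Properties as ℚP
open import Data.Rational.Solver using (module +-*-Solver)
import Data.Rational.Unnormalised as U
import Data.Rational.Unnormalised.Properties as UP
open import Data.Sum using ([_,_])
open import Data.Empty using (⊥-elim)
open import Relation.Nullary using (Dec; yes; no)
open import Relation.Binary.PropositionalEquality
open import Function using (_∘_)
open +-*-Solver using (solve; con; _:*_; _:+_; _:=_)

⟦⟧-toℚᵘ : ∀ i → toℚᵘ ⟦ i ⟧ U.≃ U.mkℚᵘ i 0
⟦⟧-toℚᵘ i = ℚP.toℚᵘ-fromℚᵘ (U.mkℚᵘ i 0)

⟦⟧-homo-* : ∀ i j → ⟦ i ℤ.* j ⟧ ≡ ⟦ i ⟧ ℚ.* ⟦ j ⟧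
⟦⟧-homo-* i j = ℚP.toℚᵘ-injective (begin
  toℚᵘ ⟦ i ℤ.* j ⟧           ≈⟨ ⟦⟧-toℚᵘ (i ℤ.* j) ⟩
  U.mkℚᵘ i 0 U.* U.mkℚᵘ j 0  ≈⟨ UP.*-cong (⟦⟧-toℚᵘ i) (⟦⟧-toℚᵘ j) ⟨
  toℚᵘ ⟦ i ⟧ U.* toℚᵘ ⟦ j ⟧  ≈⟨ ℚP.toℚᵘ-homo-* ⟦ i ⟧ ⟦ j ⟧ ⟨
  toℚᵘ (⟦ i ⟧ ℚ.* ⟦ j ⟧)     ∎)
  where open UP.≃-Reasoning

⟦⟧-homo-+ : ∀ i j → ⟦ i ℤ.+ j ⟧ ≡ ⟦ i ⟧ ℚ.+ ⟦ j ⟧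
⟦⟧-homo-+ i j = ℚP.toℚᵘ-injective (begin
  toℚᵘ ⟦ i ℤ.+ j ⟧                         ≈⟨ ⟦⟧-toℚᵘ (i ℤ.+ j) ⟩
  U.mkℚᵘ (i ℤ.+ j) 0                       ≡⟨ cong₂ (λ a b → U.mkℚᵘ (a ℤ.+ b) 0) (ℤP.*-identityʳ i) (ℤP.*-identityʳ j) ⟨
  U.mkℚᵘ i 0 U.+ U.mkℚᵘ j 0                ≈⟨ UP.+-cong (⟦⟧-toℚᵘ i) (⟦⟧-toℚᵘ j) ⟨
  toℚᵘ ⟦ i ⟧ U.+ toℚᵘ ⟦ j ⟧                ≈⟨ ℚP.toℚᵘ-homo-+ ⟦ i ⟧ ⟦ j ⟧ ⟨
  toℚᵘ (⟦ i ⟧ ℚ.+ ⟦ j ⟧)                   ∎)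
  where open UP.≃-Reasoning

⟦⟧-≢0 : ∀ {i} → i ≢ 0ℤ → ⟦ i ⟧ ≢ 0ℚ
⟦⟧-≢0 {i} i≢0 ⟦i⟧≡0 with UP.≃-trans (UP.≃-sym (⟦⟧-toℚᵘ i)) (UP.≃-reflexive (cong toℚᵘ ⟦i⟧≡0))
... | U.*≡* eq = i≢0 (trans (sym (ℤP.*-identityʳ i)) eq)

open ≡-Reasoning

i*j≢0 : ∀ {i j} → i ≢ 0ℤ → j ≢ 0ℤ → i ℤ.* j ≢ 0ℤ
i*j≢0 {i} i≢0 j≢0 ij≡0 = [ i≢0 , j≢0 ] (ℤP.i*j≡0⇒i≡0∨j≡0 i ij≡0)

inv-inverseˡ : ∀ {p} → p ≢ 0ℚ → inv p ℚ.* p ≡ 1ℚ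
inv-inverseˡ {p} p≢0 with p ℚP.≟ 0ℚ
... | yes p≡0 = ⊥-elim (p≢0 p≡0)
... | no  p≢0′ = ℚP.*-inverseˡ p {{≢-nonZero p≢0′}}

inv-unique : ∀ {p q} → p ≢ 0ℚ → q ℚ.* p ≡ 1ℚ → inv p ≡ q
inv-unique {p} {q} p≢0 qp≡1 = begin
  inv p                      ≡⟨ ℚP.*-identityʳ (inv p) ⟨
  inv p ℚ.* 1ℚ               ≡⟨ cong (inv p ℚ.*_) qp≡1 ⟨
  inv p ℚ.* (q ℚ.* p)        ≡⟨ solve 3 (λ x y z → x :* (y :* z) := y :* (x :* z)) refl (inv p) q p ⟩
  q ℚ.* (inv p ℚ.* p)        ≡⟨ cong (q ℚ.*_) (inv-inverseˡ p≢0) ⟩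
  q ℚ.* 1ℚ                   ≡⟨ ℚP.*-identityʳ q ⟩
  q                          ∎

p*q≡0⇒q≡0 : ∀ {p q} → p ≢ 0ℚ → p ℚ.* q ≡ 0ℚ → q ≡ 0ℚ
p*q≡0⇒q≡0 {p} {q} p≢0 pq≡0 = begin
  q                          ≡⟨ ℚP.*-identityˡ q ⟨
  1ℚ ℚ.* q                   ≡⟨ cong (ℚ._* q) (inv-inverseˡ p≢0) ⟨
  inv p ℚ.* p ℚ.* q          ≡⟨ ℚP.*-assoc (inv p) p q ⟩
  inv p ℚ.* (p ℚ.* q)        ≡⟨ cong (inv p ℚ.*_) pq≡0 ⟩
  inv p ℚ.* 0ℚ               ≡⟨ ℚP.*-zeroʳ (inv p) ⟩
  0ℚ                         ∎

p*q≢0 : ∀ {p q} → p ≢ 0ℚ → q ≢ 0ℚ → p ℚ.* q ≢ 0ℚ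
p*q≢0 p≢0 q≢0 = q≢0 ∘ p*q≡0⇒q≡0 p≢0

inv-homo-* : ∀ p q → inv (p ℚ.* q) ≡ inv p ℚ.* inv q
inv-homo-* p q = by-cases (p ℚP.≟ 0ℚ) (q ℚP.≟ 0ℚ)
  where
  by-cases : Dec (p ≡ 0ℚ) → Dec (q ≡ 0ℚ) → inv (p ℚ.* q) ≡ inv p ℚ.* inv q
  by-cases (yes p≡0) _ rewrite p≡0 = begin
    inv (0ℚ ℚ.* q)  ≡⟨ cong inv (ℚP.*-zeroˡ q) ⟩
    0ℚ              ≡⟨ ℚP.*-zeroˡ (inv q) ⟨
    0ℚ ℚ.* inv q    ∎
  by-cases (no _) (yes q≡0) rewrite q≡0 = begin
    inv (p ℚ.* 0ℚ)  ≡⟨ cong inv (ℚP.*-zeroʳ p) ⟩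
    0ℚ              ≡⟨ ℚP.*-zeroʳ (inv p) ⟨
    inv p ℚ.* 0ℚ    ∎
  by-cases (no p≢0) (no q≢0) = inv-unique (p*q≢0 p≢0 q≢0) (begin
    inv p ℚ.* inv q ℚ.* (p ℚ.* q)    ≡⟨ solve 4 (λ a b x y → a :* b :* (x :* y) := (a :* x) :* (b :* y)) refl (inv p) (inv q) p q ⟩
    inv p ℚ.* p ℚ.* (inv q ℚ.* q)    ≡⟨ cong₂ ℚ._*_ (inv-inverseˡ p≢0) (inv-inverseˡ q≢0) ⟩
    1ℚ                               ∎)

prodℤ-suc : ∀ a c f → prodℤ a (suc c) f ≡ prodℤ a c f ℤ.* f (a ℕ.+ c)
prodℤ-suc a zero    f = begin
  f a ℤ.* + 1          ≡⟨ ℤP.*-identityʳ (f a) ⟩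
  f a                  ≡⟨ cong f (ℕP.+-identityʳ a) ⟨
  f (a ℕ.+ 0)          ≡⟨ ℤP.*-identityˡ (f (a ℕ.+ 0)) ⟨
  + 1 ℤ.* f (a ℕ.+ 0)  ∎
prodℤ-suc a (suc c) f = begin
  f a ℤ.* prodℤ (suc a) (suc c) f                  ≡⟨ cong (f a ℤ.*_) (prodℤ-suc (suc a) c f) ⟩
  f a ℤ.* (prodℤ (suc a) c f ℤ.* f (suc a ℕ.+ c))  ≡⟨ ℤP.*-assoc (f a) _ _ ⟨
  f a ℤ.* prodℤ (suc a) c f ℤ.* f (suc a ℕ.+ c)    ≡⟨ cong (λ l → f a ℤ.* prodℤ (suc a) c f ℤ.* f l) (ℕP.+-suc a c) ⟨
  f a ℤ.* prodℤ (suc a) c f ℤ.* f (a ℕ.+ suc c)    ∎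

sumTo-telescope : ∀ (t q : ℕ → ℚ) κ d → q 0 ℚ.+ κ ≡ 0ℚ →
  (∀ k → k < d → t k ℚ.* q k ≡ t (suc k) ℚ.* (q (suc k) ℚ.+ κ)) →
  ∀ j → j ≤ d → κ ℚ.* sumTo (suc j) t ℚ.+ t j ℚ.* q j ≡ 0ℚ
sumTo-telescope t q κ d q₀+κ≡0 step zero _ = begin
  κ ℚ.* (0ℚ ℚ.+ t 0) ℚ.+ t 0 ℚ.* q 0   ≡⟨ solve 3 (λ k x y → k :* (con 0ℚ :+ x) :+ x :* y := x :* (y :+ k)) refl κ (t 0) (q 0) ⟩
  t 0 ℚ.* (q 0 ℚ.+ κ)                  ≡⟨ cong (t 0 ℚ.*_) q₀+κ≡0 ⟩
  t 0 ℚ.* 0ℚ                           ≡⟨ ℚP.*-zeroʳ (t 0) ⟩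
  0ℚ                                   ∎
sumTo-telescope t q κ d q₀+κ≡0 step (suc j) j<d = begin
  κ ℚ.* (S ℚ.+ t (suc j)) ℚ.+ t (suc j) ℚ.* q (suc j)
    ≡⟨ solve 4 (λ k s x y → k :* (s :+ x) :+ x :* y := k :* s :+ x :* (y :+ k)) refl κ S (t (suc j)) (q (suc j)) ⟩
  κ ℚ.* S ℚ.+ t (suc j) ℚ.* (q (suc j) ℚ.+ κ)
    ≡⟨ cong (κ ℚ.* S ℚ.+_) (step j j<d) ⟨
  κ ℚ.* S ℚ.+ t j ℚ.* q j
    ≡⟨ sumTo-telescope t q κ d q₀+κ≡0 step j (ℕP.<⇒≤ j<d) ⟩
  0ℚ ∎
  where
  S = sumTo (suc j) t

sumTo-telescope-vanishes : ∀ (t q : ℕ → ℚ) κ d → κ ≢ 0ℚ → q 0 ℚ.+ κ ≡ 0ℚ →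
  (∀ k → k < d → t k ℚ.* q k ≡ t (suc k) ℚ.* (q (suc k) ℚ.+ κ)) →
  q d ≡ 0ℚ → sumTo (suc d) t ≡ 0ℚ
sumTo-telescope-vanishes t q κ d κ≢0 q₀+κ≡0 step q_d≡0 = p*q≡0⇒q≡0 κ≢0 (begin
  κ ℚ.* S                    ≡⟨ ℚP.+-identityʳ (κ ℚ.* S) ⟨
  κ ℚ.* S ℚ.+ 0ℚ             ≡⟨ cong (κ ℚ.* S ℚ.+_) (ℚP.*-zeroʳ (t d)) ⟨
  κ ℚ.* S ℚ.+ t d ℚ.* 0ℚ     ≡⟨ cong (λ x → κ ℚ.* S ℚ.+ t d ℚ.* x) q_d≡0 ⟨
  κ ℚ.* S ℚ.+ t d ℚ.* q d    ≡⟨ sumTo-telescope t q κ d q₀+κ≡0 step d ℕP.≤-refl ⟩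
  0ℚ                         ∎)
  where
  S = sumTo (suc d) t

module Summands (n m : ℤ) (d : ℕ) where

  t : ℕ → ℚ
  t k = coeff n m d k ℚ.* r n m k

  Q : ℕ → ℤ
  Q k = facC d k ℤ.* facB n m d k

  E : ℕ → ℤ
  E k = + 2 ℤ.* + suc k ℤ.* facA n m k

  K : ℤ
  K = + 2 ℤ.* + d ℤ.* facB n m d 0

  denom-r : ℕ → ℤ
  denom-r k = + (2 ℕ.^ k) ℤ.* + (k !) ℤ.* prodℤ 0 k (facA n m)

  denom-r-suc : ∀ k → denom-r (suc k) ≡ denom-r k ℤ.* E k
  denom-r-suc k = begin
    + (2 ℕ.* 2 ℕ.^ k) ℤ.* + (suc k ℕ.* k !) ℤ.* prodℤ 0 (suc k) A
      ≡⟨ cong₂ (λ x y → x ℤ.* y ℤ.* prodℤ 0 (suc k) A) (ℤP.pos-* 2 (2 ℕ.^ k)) (ℤP.pos-* (suc k) (k !)) ⟩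
    + 2 ℤ.* + (2 ℕ.^ k) ℤ.* (+ suc k ℤ.* + (k !)) ℤ.* prodℤ 0 (suc k) A
      ≡⟨ cong (+ 2 ℤ.* + (2 ℕ.^ k) ℤ.* (+ suc k ℤ.* + (k !)) ℤ.*_) (prodℤ-suc 0 k A) ⟩
    + 2 ℤ.* + (2 ℕ.^ k) ℤ.* (+ suc k ℤ.* + (k !)) ℤ.* (prodℤ 0 k A ℤ.* A k)
      ≡⟨ rearrange (+ 2) (+ (2 ℕ.^ k)) (+ suc k) (+ (k !)) (prodℤ 0 k A) (A k) ⟩
    denom-r k ℤ.* E k ∎
    where
    A = facA n m
    rearrange : ∀ a b c e p x → a ℤ.* b ℤ.* (c ℤ.* e) ℤ.* (p ℤ.* x) ≡ b ℤ.* e ℤ.* p ℤ.* (a ℤ.* c ℤ.* x)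
    rearrange = solve-∀

  r-suc : ∀ k → r n m (suc k) ≡ r n m k ℚ.* inv ⟦ E k ⟧
  r-suc k = begin
    inv ⟦ denom-r (suc k) ⟧              ≡⟨ cong (inv ∘ ⟦_⟧) (denom-r-suc k) ⟩
    inv ⟦ denom-r k ℤ.* E k ⟧            ≡⟨ cong inv (⟦⟧-homo-* (denom-r k) (E k)) ⟩
    inv (⟦ denom-r k ⟧ ℚ.* ⟦ E k ⟧)      ≡⟨ inv-homo-* ⟦ denom-r k ⟧ ⟦ E k ⟧ ⟩
    inv ⟦ denom-r k ⟧ ℚ.* inv ⟦ E k ⟧    ∎

  coeff-pred : ∀ {k} → k < d → coeff n m d k ≡ inv ⟦ Q k ⟧ ℚ.* coeff n m d (suc k)
  coeff-pred {k} k<d rewrite ℕP.+-∸-assoc 1 k<d = refl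

  t-ratio : ∀ {k} → k < d → Q k ≢ 0ℤ → E k ≢ 0ℤ → t k ℚ.* ⟦ Q k ⟧ ≡ t (suc k) ℚ.* ⟦ E k ⟧
  t-ratio {k} k<d Q≢0 E≢0 = begin
    c ℚ.* ρ ℚ.* q                    ≡⟨ cong (λ x → x ℚ.* ρ ℚ.* q) (coeff-pred k<d) ⟩
    inv q ℚ.* c′ ℚ.* ρ ℚ.* q         ≡⟨ solve 4 (λ a b x y → a :* b :* x :* y := b :* x :* (a :* y)) refl (inv q) c′ ρ q ⟩
    c′ ℚ.* ρ ℚ.* (inv q ℚ.* q)       ≡⟨ cong (c′ ℚ.* ρ ℚ.*_) (trans (inv-inverseˡ (⟦⟧-≢0 Q≢0)) (sym (inv-inverseˡ (⟦⟧-≢0 E≢0)))) ⟩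
    c′ ℚ.* ρ ℚ.* (inv e ℚ.* e)       ≡⟨ solve 4 (λ a b x y → b :* x :* (a :* y) := b :* (x :* a) :* y) refl (inv e) c′ ρ e ⟩
    c′ ℚ.* (ρ ℚ.* inv e) ℚ.* e       ≡⟨ cong (λ x → c′ ℚ.* x ℚ.* e) (r-suc k) ⟨
    t (suc k) ℚ.* e                  ∎
    where
    c = coeff n m d k
    c′ = coeff n m d (suc k)
    ρ = r n m k
    q = ⟦ Q k ⟧
    e = ⟦ E k ⟧

  Q-suc : ∀ k → Q (suc k) ℤ.+ K ≡ E k
  Q-suc k = identity n m (+ d) (+ k)
    where
    -- at k := + k the term + 1 ℤ.+ k reduces to + suc k
    identity : ∀ n m d k →
      (+ 2 ℤ.* (+ 1 ℤ.+ k) ℤ.- + 2 ℤ.* d) ℤ.* (n ℤ.- + 2 ℤ.+ + 2 ℤ.* m ℤ.- + 2 ℤ.* d ℤ.- + 2 ℤ.* (+ 1 ℤ.+ k))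
        ℤ.+ + 2 ℤ.* d ℤ.* (n ℤ.- + 2 ℤ.+ + 2 ℤ.* m ℤ.- + 2 ℤ.* d ℤ.- + 2 ℤ.* + 0)
      ≡ + 2 ℤ.* (+ 1 ℤ.+ k) ℤ.* (n ℤ.+ + 2 ℤ.* m ℤ.- + 4 ℤ.- + 2 ℤ.* k)
    identity = solve-∀

  Q-zero : Q 0 ℤ.+ K ≡ 0ℤ
  Q-zero = identity n m (+ d)
    where
    identity : ∀ n m d →
      (+ 2 ℤ.* + 0 ℤ.- + 2 ℤ.* d) ℤ.* (n ℤ.- + 2 ℤ.+ + 2 ℤ.* m ℤ.- + 2 ℤ.* d ℤ.- + 2 ℤ.* + 0)
        ℤ.+ + 2 ℤ.* d ℤ.* (n ℤ.- + 2 ℤ.+ + 2 ℤ.* m ℤ.- + 2 ℤ.* d ℤ.- + 2 ℤ.* + 0)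
      ≡ 0ℤ
    identity = solve-∀

  Q-last : Q d ≡ 0ℤ
  Q-last = begin
    (+ 2 ℤ.* + d ℤ.- + 2 ℤ.* + d) ℤ.* facB n m d d  ≡⟨ cong (ℤ._* facB n m d d) (ℤP.+-inverseʳ (+ 2 ℤ.* + d)) ⟩
    0ℤ ℤ.* facB n m d d                            ≡⟨ ℤP.*-zeroˡ (facB n m d d) ⟩
    0ℤ                                             ∎

  t-step : ∀ {k} → k < d → Q k ≢ 0ℤ → E k ≢ 0ℤ → t k ℚ.* ⟦ Q k ⟧ ≡ t (suc k) ℚ.* (⟦ Q (suc k) ⟧ ℚ.+ ⟦ K ⟧)
  t-step {k} k<d Q≢0 E≢0 = begin
    t k ℚ.* ⟦ Q k ⟧                          ≡⟨ t-ratio k<d Q≢0 E≢0 ⟩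
    t (suc k) ℚ.* ⟦ E k ⟧                    ≡⟨ cong (λ x → t (suc k) ℚ.* ⟦ x ⟧) (Q-suc k) ⟨
    t (suc k) ℚ.* ⟦ Q (suc k) ℤ.+ K ⟧        ≡⟨ cong (t (suc k) ℚ.*_) (⟦⟧-homo-+ (Q (suc k)) K) ⟩
    t (suc k) ℚ.* (⟦ Q (suc k) ⟧ ℚ.+ ⟦ K ⟧)  ∎

lemma5p3 : (n m : ℤ) (d : ℕ) → 1 ≤ d →
    (∀ l → l < d → facA n m l ≢ 0ℤ) →
    (∀ l → l < d → facB n m d l ≢ 0ℤ) →
    (∀ l → l < d → facC d l ≢ 0ℤ) →
    theSum n m d ≡ 0ℚ
lemma5p3 n m d 1≤d A≢0 B≢0 C≢0 =
  sumTo-telescope-vanishes t (⟦_⟧ ∘ Q) ⟦ K ⟧ d (⟦⟧-≢0 K≢0)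
    (trans (sym (⟦⟧-homo-+ (Q 0) K)) (cong ⟦_⟧ Q-zero))
    (λ k k<d → t-step k<d (i*j≢0 (C≢0 k k<d) (B≢0 k k<d)) (i*j≢0 {+ 2 ℤ.* + suc k} (λ ()) (A≢0 k k<d)))
    (cong ⟦_⟧ Q-last)
  where
  open Summands n m d
  K≢0 : K ≢ 0ℤ
  K≢0 = i*j≢0 (i*j≢0 {+ 2} (λ ()) (ℕP.n>0⇒n≢0 1≤d ∘ ℤP.+-injective)) (B≢0 0 1≤d)
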